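{- For each $\mathcal{L}_L$-formula $\phi(X_1,\dots,X_n)$ there is an $\mathcal{L}_W$-formula $\psi(Y_1,\dots,Y_n,Z_1,\dots,Z_n)$ such that for all $A_1,\dots,A_n\in\mathcal{P}_{\mathrm{fci}}(\mathbb{I})$, $$L(\mathbb{I})\models\phi(A_1,\dots,A_n)\iff W(\mathbb{I})\models\psi((A_1)_l,\dots,(A_n)_l,(A_1)_r,\dots,(A_n)_r).$$
   Context: $\mathbb{I}$ is a fixed dense linear order with a least element, denoted $0$, and no greatest element. $\mathcal{L}_{W}=\{\cup,\cap,\bot,\mathbf{0},\min,\max,\mathfrak{s}^{ -1}\}$ (binary $\cup,\cap$; constants $\bot,\mathbf{0}$; unary $\min,\max$; binary $\mathfrak{s}^{ -1}$). $W(\mathbb{I})$ is the $\mathcal{L}_W$-structure with universe the finite subsets of $\mathbb{I}$, $\cup,\cap$ union and intersection, $\bot=\emptyset$, $\mathbf{0}=\{0\}$, $\min(A),\max(A)$ the singletons of the least/greatest element of nonempty $A$ (both $\emptyset$ at $\emptyset$), and $\mathfrak{s}^{ -1}(A,B)=\{i\in A: i$ has a successor $s_A(i)$ in $A$ and $s_A(i)\in B\}$. A closed interval of $\mathbb{I}$ is $[i,j]$, $[i,+\infty)$ or $(-\infty,j]$; $\mathcal{P}_{\mathrm{fci}}(\mathbb{I})$ is the set of finite unions of closed intervals. For $A\in\mathcal{P}_{\mathrm{fci}}(\mathbb{I})$, writing $A$ as the union of its finitely many maximal convex subsets, $A_l$ is the set of their least elements and $A_r$ the set of greatest elements of those that have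 one. $\mathcal{L}_L=\{\cup,\cap,\bot,\mathbf{0},\min,\max,l,r\}$; $L(\mathbb{I})$ is the $\mathcal{L}_L$-structure with universe $\mathcal{P}_{\mathrm{fci}}(\mathbb{I})$, $\cup,\cap$ union and intersection, $\bot=\emptyset$, $\mathbf{0}=\{0\}$, $\min(A)$ the singleton of the least element ($\emptyset$ for $A=\emptyset$), $\max(A)$ the singleton of the greatest element if $A$ is nonempty and bounded above and $\emptyset$ otherwise, $l(A)=A_l$, $r(A)=A_r$. -}

module Defs where

import Level
open import Level using (0ℓ) renaming (suc to lsuc)
open import Data.Nat using (ℕ; suc; _+_)
open import Data.Fin using (Fin; splitAt)
open import Data.Fin.Base using (zero; suc)
open import Data.Empty using (⊥)
open import Data.Product using (Σ; ∃; _×_; _,_)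
open import Data.Sum using (_⊎_; [_,_]′)
open import Data.List using (List)
open import Data.List.Membership.Propositional using (_∈_)
open import Data.List.Relation.Unary.Any using (Any)
open import Relation.Nullary using (¬_)
open import Relation.Binary.PropositionalEquality using (_≡_)
open import Relation.Binary.Structures using (IsStrictTotalOrder)

record DLO : Set₁ where
  field
    Carrier   : Set
    _<_       : Carrier → Carrier → Set
    isSTO     : IsStrictTotalOrder _≡_ _<_
    0#        : Carrier
    least     : ∀ x → ¬ (x < 0#)
    dense     : ∀ {x y} → x < y → Σ Carrier λ z → (x < z) × (z < y)
    noGreatest : ∀ x → Σ Carrier λ y → x < y

-- Syntax.  Both languages have only function and constant symbols, so
-- the only atomic formulas are equations between terms.
-- Variables are de Bruijn indices: Fin n.

data TermW (n : ℕ) : Set where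
  var   : Fin n → TermW n
  _∪_   : TermW n → TermW n → TermW n
  _∩_   : TermW n → TermW n → TermW n
  bot   : TermW n
  zero𝟎 : TermW n
  min   : TermW n → TermW n
  max   : TermW n → TermW n
  s⁻¹   : TermW n → TermW n → TermW n

data TermL (n : ℕ) : Set where
  var   : Fin n → TermL n
  _∪_   : TermL n → TermL n → TermL n
  _∩_   : TermL n → TermL n → TermL n
  bot   : TermL n
  zero𝟎 : TermL n
  min   : TermL n → TermL n
  max   : TermL n → TermL n
  l     : TermL n → TermL n
  r     : TermL n → TermL n

data Formula (T : ℕ → Set) (n : ℕ) : Set where
  _≐_  : T n → T n → Formula T n
  ⊥'   : Formula T n
  ¬'_  : Formula T n → Formula T n
  _∧'_ : Formula T n → Formula T n → Formula T n
  _∨'_ : Formula T n → Formula T n → Formula T n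
  _⇒'_ : Formula T n → Formula T n → Formula T n
  ∀'   : Formula T (suc n) → Formula T n
  ∃'   : Formula T (suc n) → Formula T n

-- Subsets of 𝕀 are predicates; equality of subsets is
-- extensional.

module _ (I : DLO) where
  open DLO I

  Subset : Set₁
  Subset = Carrier → Set

  _≤_ : Carrier → Carrier → Set
  x ≤ y = (x < y) ⊎ (x ≡ y)

  IsFinite : Subset → Set
  IsFinite A = Σ (List Carrier) λ xs → ∀ x → (A x → x ∈ xs) × (x ∈ xs → A x)

  data ClosedInterval : Set where
    [_,_]  : Carrier → Carrier → ClosedInterval
    [_,+∞] : Carrier → ClosedInterval
    [-∞,_] : Carrier → ClosedInterval

  _∈ᵢ_ : Carrier → ClosedInterval → Set
  x ∈ᵢ [ i , j ] = (i ≤ x) × (x ≤ j)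
  x ∈ᵢ [ i ,+∞]  = i ≤ x
  x ∈ᵢ [-∞, j ]  = x ≤ j

  IsFci : Subset → Set
  IsFci A = Σ (List ClosedInterval) λ is →
              ∀ x → (A x → Any (x ∈ᵢ_) is) × (Any (x ∈ᵢ_) is → A x)

  ∅ˢ : Subset
  ∅ˢ _ = ⊥

  𝟎ˢ : Subset
  𝟎ˢ x = x ≡ 0#

  _∪ˢ_ _∩ˢ_ : Subset → Subset → Subset
  (A ∪ˢ B) x = A x ⊎ B x
  (A ∩ˢ B) x = A x × B x

  minˢ : Subset → Subset
  minˢ A x = A x × (∀ y → A y → ¬ (y < x))

  maxˢ : Subset → Subset
  maxˢ A x = A x × (∀ y → A y → ¬ (x < y))

  IsSucc : Subset → Carrier → Carrier → Set
  IsSucc A i j = A j × (i < j) × (∀ k → A k → i < k → ¬ (k < j))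

  s⁻¹ˢ : Subset → Subset → Subset
  s⁻¹ˢ A B i = A i × Σ Carrier λ j → IsSucc A i j × B j

  -- x and y lie in the same maximal convex subset of A:
  -- the whole closed interval between them is contained in A.
  SameComp : Subset → Carrier → Carrier → Set
  SameComp A x y = ∀ z → ((x ≤ z × z ≤ y) ⊎ (y ≤ z × z ≤ x)) → A z

  lˢ : Subset → Subset
  lˢ A x = A x × (∀ y → SameComp A x y → ¬ (y < x))

  rˢ : Subset → Subset
  rˢ A x = A x × (∀ y → SameComp A x y → ¬ (x < y))

  Env : ℕ → Set₁
  Env n = Fin n → Subset

  extend : ∀ {n} → Subset → Env n → Env (suc n)
  extend X ρ zero    = X
  extend X ρ (suc i) = ρ i

  evalW : ∀ {n} → TermW n → Env n → Subset
  evalW (var i)   ρ = ρ i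
  evalW (t ∪ u)   ρ = evalW t ρ ∪ˢ evalW u ρ
  evalW (t ∩ u)   ρ = evalW t ρ ∩ˢ evalW u ρ
  evalW bot       ρ = ∅ˢ
  evalW zero𝟎     ρ = 𝟎ˢ
  evalW (min t)   ρ = minˢ (evalW t ρ)
  evalW (max t)   ρ = maxˢ (evalW t ρ)
  evalW (s⁻¹ t u) ρ = s⁻¹ˢ (evalW t ρ) (evalW u ρ)

  evalL : ∀ {n} → TermL n → Env n → Subset
  evalL (var i) ρ = ρ i
  evalL (t ∪ u) ρ = evalL t ρ ∪ˢ evalL u ρ
  evalL (t ∩ u) ρ = evalL t ρ ∩ˢ evalL u ρ
  evalL bot     ρ = ∅ˢ
  evalL zero𝟎   ρ = 𝟎ˢ
  evalL (min t) ρ = minˢ (evalL t ρ)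
  evalL (max t) ρ = maxˢ (evalL t ρ)
  evalL (l t)   ρ = lˢ (evalL t ρ)
  evalL (r t)   ρ = rˢ (evalL t ρ)

  Sat : {T : ℕ → Set} → (Subset → Set) →
        (∀ {n} → T n → Env n → Subset) →
        ∀ {n} → Formula T n → Env n → Set₁
  Sat U ev (t ≐ u)  ρ = Level.Lift (lsuc 0ℓ) (∀ x → (ev t ρ x → ev u ρ x) × (ev u ρ x → ev t ρ x))
  Sat U ev ⊥'       ρ = Level.Lift (lsuc 0ℓ) ⊥
  Sat U ev (¬' φ)   ρ = Sat U ev φ ρ → Level.Lift (lsuc 0ℓ) ⊥
  Sat U ev (φ ∧' ψ) ρ = Sat U ev φ ρ × Sat U ev ψ ρ
  Sat U ev (φ ∨' ψ) ρ = Sat U ev φ ρ ⊎ Sat U ev ψ ρ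
  Sat U ev (φ ⇒' ψ) ρ = Sat U ev φ ρ → Sat U ev ψ ρ
  Sat U ev (∀' φ)   ρ = (X : Subset) → U X → Sat U ev φ (extend X ρ)
  Sat U ev (∃' φ)   ρ = Σ Subset λ X → U X × Sat U ev φ (extend X ρ)

  ⊨L : ∀ {n} → Formula TermL n → Env n → Set₁
  ⊨L φ ρ = Sat IsFci evalL φ ρ

  ⊨W : ∀ {n} → Formula TermW n → Env n → Set₁
  ⊨W ψ ρ = Sat IsFinite evalW ψ ρ

  lrEnv : ∀ n → Env n → Env (n + n)
  lrEnv n A i = [ (λ j → lˢ (A j)) , (λ j → rˢ (A j)) ]′ (splitAt n i)

-- A finite union X of closed intervals is recovered from its left ends X_l and right ends X_r:
-- x ∈ X iff some a ∈ X_l with a ≤ x has no point of X_r in [a, x).  Conversely, for arbitrary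
-- finite Y and Z this recipe gives a finite union of closed intervals (from each a ∈ Y to the
-- next point of Z above it).  Hence a quantifier over L(𝕀) becomes two quantifiers over W(𝕀),
-- and an L-term becomes a W-formula saying that a point lies in its value; points of 𝕀 are
-- represented in W(𝕀) by singletons, i.e. the nonempty sets X with min X = X.
module Submission where

open import Defs hiding (_≤_; _∈ᵢ_)
open import Level using (Lift; lift; lower) renaming (suc to lsuc; zero to lzero)
open import Axiom.ExcludedMiddle using (ExcludedMiddle)
open import Data.Nat using (ℕ; suc; _+_)
open import Data.Fin using (Fin; zero; suc; _↑ˡ_; _↑ʳ_)
open import Data.Fin.Properties using (splitAt-↑ˡ; splitAt-↑ʳ)
open import Data.Product using (Σ; ∃; ∃-syntax; _×_; _,_; proj₁; proj₂)
open import Data.Sum using (_⊎_; inj₁; inj₂; swap)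
open import Data.Empty using (⊥; ⊥-elim)
open import Data.Maybe using (Maybe; just; nothing)
import Data.Maybe.Relation.Unary.Any as Maybe
open import Data.List using (List; []; _∷_; map; mapMaybe; filter)
open import Data.List.Relation.Unary.Any as Any using (Any; here; there)
open import Data.List.Relation.Unary.Any.Properties using (map⁺; map⁻; mapMaybe⁺; ¬Any[])
open import Data.List.Membership.Propositional using (_∈_; find; lose)
open import Data.List.Membership.Propositional.Properties using (∈-map⁺; ∈-filter⁺; ∈-filter⁻)
open import Function using (_∘_; flip)
open import Function.Bundles using (_⇔_; mk⇔; Equivalence)
open import Function.Construct.Identity using (⇔-id)
open import Function.Construct.Symmetry using (⇔-sym)
open import Function.Construct.Composition using () renaming (equivalence to ⇔-trans)
open import Function.Related.TypeIsomorphisms using (→-cong-⇔)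
open import Data.Product.Function.NonDependent.Propositional using (_×-⇔_)
open import Data.Sum.Function.Propositional using (_⊎-⇔_)
open import Relation.Nullary using (¬_; Dec; yes; no)
open import Relation.Nullary.Decidable using (map′)
open import Relation.Binary.Definitions using (Transitive; Irreflexive; tri<; tri≈; tri>)
open import Relation.Binary.PropositionalEquality using (_≡_; refl; sym; trans; subst; resp₂)
open import Relation.Binary.Structures using (IsStrictTotalOrder)
import Relation.Binary.Construct.StrictToNonStrict as StrictToNonStrict

private variable
  m n : ℕ

∈-mapMaybe⁺ : ∀ {A B : Set} (f : A → Maybe B) {xs x y} → x ∈ xs → f x ≡ just y → y ∈ mapMaybe f xs
∈-mapMaybe⁺ f x∈xs fx≡y =
  mapMaybe⁺ f _ (map⁺ (Any.map (λ { refl → subst (Maybe.Any (_ ≡_)) (sym fx≡y) (Maybe.just refl) }) x∈xs))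

module Order (I : DLO) where
  open DLO I
  open IsStrictTotalOrder isSTO public using (compare) renaming (trans to <-trans; irrefl to <-irrefl)
  private module NS = StrictToNonStrict _≡_ _<_

  infix 4 _≤_
  _≤_ : Carrier → Carrier → Set
  _≤_ = Defs._≤_ I

  ≤-refl : ∀ {x} → x ≤ x
  ≤-refl = NS.reflexive refl

  ≤-trans : ∀ {x y z} → x ≤ y → y ≤ z → x ≤ z
  ≤-trans = NS.trans (IsStrictTotalOrder.isEquivalence isSTO) (resp₂ _<_) <-trans

  <-≤-trans : ∀ {x y z} → x < y → y ≤ z → x < z
  <-≤-trans = NS.<-≤-trans <-trans (proj₁ (resp₂ _<_))

  ≤-<-trans : ∀ {x y z} → x ≤ y → y < z → x < z
  ≤-<-trans = NS.≤-<-trans sym <-trans (proj₂ (resp₂ _<_))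

  ≤⊎> : ∀ x y → x ≤ y ⊎ y < x
  ≤⊎> x y with compare x y
  ... | tri< x<y _ _ = inj₁ (inj₁ x<y)
  ... | tri≈ _ x≡y _ = inj₁ (inj₂ x≡y)
  ... | tri> _ _ y<x = inj₂ y<x

  ≮⇒≥ : ∀ {x y} → ¬ y < x → x ≤ y
  ≮⇒≥ {x} {y} y≮x with ≤⊎> x y
  ... | inj₁ x≤y = x≤y
  ... | inj₂ y<x = ⊥-elim (y≮x y<x)

  ≤⇒≯ : ∀ {x y} → x ≤ y → ¬ y < x
  ≤⇒≯ x≤y y<x = <-irrefl refl (≤-<-trans x≤y y<x)

  ≤∧≮⇒≡ : ∀ {x y} → x ≤ y → ¬ x < y → x ≡ y
  ≤∧≮⇒≡ (inj₁ x<y) x≮y = ⊥-elim (x≮y x<y)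
  ≤∧≮⇒≡ (inj₂ x≡y) _   = x≡y

  ≤∧≢⇔< : ∀ {x y} → (x ≤ y × ¬ x ≡ y) ⇔ x < y
  ≤∧≢⇔< = mk⇔ to (λ x<y → inj₁ x<y , λ { refl → <-irrefl refl x<y })
    where
    to : ∀ {x y} → x ≤ y × ¬ x ≡ y → x < y
    to (inj₁ x<y , _)   = x<y
    to (inj₂ x≡y , x≢y) = ⊥-elim (x≢y x≡y)

  0≤ : ∀ x → 0# ≤ x
  0≤ x = ≮⇒≥ (least x)

module Endpoints (I : DLO) (em : ExcludedMiddle (lsuc lzero)) where
  open DLO I
  open Order I

  decide : (P : Set) → Dec P
  decide P = map′ lower lift em

  MinimalIn : (Carrier → Carrier → Set) → (Carrier → Set) → List Carrier → Carrier → Set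
  MinimalIn R P xs m = m ∈ xs × P m × (∀ {y} → y ∈ xs → P y → ¬ R y m)

  minimalIn : ∀ {R} {P : Carrier → Set} → Transitive R → Irreflexive _≡_ R →
              ∀ xs → Any P xs → ∃ (MinimalIn R P xs)
  minimalIn {R} {P} R-trans R-irrefl (x ∷ xs) Pxs with decide (Any P xs)
  ... | no ¬Ptail = x , here refl , Any.head ¬Ptail Pxs , λ
    { (here refl) _  → R-irrefl refl
    ; (there y∈) Py _ → ¬Ptail (lose y∈ Py) }
  ... | yes Ptail with minimalIn R-trans R-irrefl xs Ptail
  ... | m , m∈ , Pm , m-min with decide (P x × R x m)
  ...   | yes (Px , Rxm) = x , here refl , Px , λ
    { (here refl) _ → R-irrefl refl
    ; (there y∈) Py Ryx → m-min y∈ Py (R-trans Ryx Rxm) }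
  ...   | no ¬PxRxm = m , there m∈ , Pm , λ
    { (here refl) Px Rxm → ¬PxRxm (Px , Rxm)
    ; (there y∈) → m-min y∈ }

  listed⇒finite : {P : Carrier → Set} {xs : List Carrier} → (∀ {x} → P x → x ∈ xs) → IsFinite I P
  listed⇒finite {P} {xs} P⊆xs =
    filter P? xs , λ x → (λ Px → ∈-filter⁺ P? (P⊆xs Px) Px) ,
                         (λ x∈ → proj₂ (∈-filter⁻ P? {xs = xs} x∈))
    where
    P? : ∀ x → Dec (P x)
    P? x = decide (P x)

  infix 4 _∈ᵢ_
  _∈ᵢ_ : Carrier → ClosedInterval I → Set
  _∈ᵢ_ = Defs._∈ᵢ_ I

  [_,_]⊆_ : Carrier → Carrier → Subset I → Set
  [ u , v ]⊆ X = ∀ {z} → u ≤ z → z ≤ v → X z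

  ⊆-join : ∀ {X u v w} → [ u , v ]⊆ X → [ v , w ]⊆ X → [ u , w ]⊆ X
  ⊆-join {v = v} [u,v]⊆X [v,w]⊆X {z} u≤z z≤w with ≤⊎> z v
  ... | inj₁ z≤v = [u,v]⊆X u≤z z≤v
  ... | inj₂ v<z = [v,w]⊆X (inj₁ v<z) z≤w

  SameComp⇒⊆ : ∀ {X x y} → SameComp I X x y → [ x , y ]⊆ X
  SameComp⇒⊆ sc x≤z z≤y = sc _ (inj₁ (x≤z , z≤y))

  ⊆⇒SameComp : ∀ {X x y} → x ≤ y → [ x , y ]⊆ X → SameComp I X x y
  ⊆⇒SameComp x≤y [x,y]⊆X z (inj₁ (x≤z , z≤y)) = [x,y]⊆X x≤z z≤y
  ⊆⇒SameComp x≤y [x,y]⊆X z (inj₂ (y≤z , z≤x)) = [x,y]⊆X (≤-trans x≤y y≤z) (≤-trans z≤x x≤y)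

  SameComp-sym : ∀ {X x y} → SameComp I X x y → SameComp I X y x
  SameComp-sym sc z = sc z ∘ swap

  lowerBound : ClosedInterval I → Carrier
  lowerBound [ i , _ ] = i
  lowerBound [ i ,+∞]  = i
  lowerBound [-∞, _ ]  = 0#   -- (-∞, j] = [0, j] as 0 is least

  upperBound : ClosedInterval I → Maybe Carrier
  upperBound [ _ , j ] = just j
  upperBound [ _ ,+∞]  = nothing
  upperBound [-∞, j ]  = just j

  lowerBound-≤ : ∀ J {x} → x ∈ᵢ J → lowerBound J ≤ x × [ lowerBound J , x ]⊆ (_∈ᵢ J)
  lowerBound-≤ [ i , j ] (i≤x , x≤j) = i≤x , λ i≤z z≤x → i≤z , ≤-trans z≤x x≤j
  lowerBound-≤ [ i ,+∞]  i≤x         = i≤x , λ i≤z _ → i≤z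
  lowerBound-≤ [-∞, j ]  x≤j         = 0≤ _ , λ _ z≤x → ≤-trans z≤x x≤j

  upperBound-≥ : ∀ J {x} → x ∈ᵢ J →
                 (∀ {z} → x ≤ z → z ∈ᵢ J) ⊎
                 ∃[ e ] upperBound J ≡ just e × x ≤ e × [ x , e ]⊆ (_∈ᵢ J)
  upperBound-≥ [ i , j ] (i≤x , x≤j) = inj₂ (j , refl , x≤j , λ x≤z z≤j → ≤-trans i≤x x≤z , z≤j)
  upperBound-≥ [ i ,+∞]  i≤x         = inj₁ (λ x≤z → ≤-trans i≤x x≤z)
  upperBound-≥ [-∞, j ]  x≤j         = inj₂ (j , refl , x≤j , λ _ z≤j → z≤j)

  Misses : Subset I → Carrier → Carrier → Set
  Misses Z a x = ∀ b → Z b → a ≤ b → ¬ b < x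

  fromEndpoints : Subset I → Subset I → Subset I
  fromEndpoints Y Z x = ∃[ a ] Y a × a ≤ x × Misses Z a x

  module _ {X : Subset I} (fci : IsFci I X) where
    private
      intervals : List (ClosedInterval I)
      intervals = proj₁ fci

      ⋃⇒X : ∀ {x} → Any (x ∈ᵢ_) intervals → X x
      ⋃⇒X = proj₂ (proj₂ fci _)

      X⇒⋃ : ∀ {x} → X x → Any (x ∈ᵢ_) intervals
      X⇒⋃ = proj₁ (proj₂ fci _)

    lowerEndpoint : ∀ {x} → X x → ∃[ e ] e ∈ map lowerBound intervals × e ≤ x × [ e , x ]⊆ X
    lowerEndpoint Xx with find (X⇒⋃ Xx)
    ... | J , J∈ , x∈J with lowerBound-≤ J x∈J
    ...   | e≤x , [e,x]⊆J =
      lowerBound J , ∈-map⁺ lowerBound J∈ , e≤x , λ e≤z z≤x → ⋃⇒X (lose J∈ ([e,x]⊆J e≤z z≤x))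

    upperEndpoint : ∀ {x} → X x →
                    (∀ {z} → x ≤ z → X z) ⊎
                    ∃[ e ] e ∈ mapMaybe upperBound intervals × x ≤ e × [ x , e ]⊆ X
    upperEndpoint Xx with find (X⇒⋃ Xx)
    ... | J , J∈ , x∈J with upperBound-≥ J x∈J
    ...   | inj₁ x↑⊆J = inj₁ (λ x≤z → ⋃⇒X (lose J∈ (x↑⊆J x≤z)))
    ...   | inj₂ (e , upper≡e , x≤e , [x,e]⊆J) =
      inj₂ (e , ∈-mapMaybe⁺ upperBound J∈ upper≡e , x≤e ,
            λ x≤z z≤e → ⋃⇒X (lose J∈ ([x,e]⊆J x≤z z≤e)))

    lˢ-finite : IsFinite I (lˢ I X)
    lˢ-finite = listed⇒finite left∈lowers
      where
      left∈lowers : ∀ {a} → lˢ I X a → a ∈ map lowerBound intervals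
      left∈lowers (Xa , a-left) with lowerEndpoint Xa
      ... | e , e∈ , e≤a , [e,a]⊆X =
        subst (_∈ _) (≤∧≮⇒≡ e≤a (a-left e (SameComp-sym (⊆⇒SameComp e≤a [e,a]⊆X)))) e∈

    rˢ-finite : IsFinite I (rˢ I X)
    rˢ-finite = listed⇒finite right∈uppers
      where
      right∈uppers : ∀ {b} → rˢ I X b → b ∈ mapMaybe upperBound intervals
      right∈uppers {b} (Xb , b-right) with upperEndpoint Xb
      ... | inj₁ b↑⊆X =
        let (c , b<c) = noGreatest b in
        ⊥-elim (b-right c (⊆⇒SameComp (inj₁ b<c) (λ b≤z _ → b↑⊆X b≤z)) b<c)
      ... | inj₂ (e , e∈ , b≤e , [b,e]⊆X) =
        subst (_∈ _) (sym (≤∧≮⇒≡ b≤e (b-right e (⊆⇒SameComp b≤e [b,e]⊆X)))) e∈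

    upperEndpointBelow : ∀ {x y} → ¬ X x → X y → y ≤ x →
                         ∃[ e ] e ∈ mapMaybe upperBound intervals × y ≤ e × e < x × [ y , e ]⊆ X
    upperEndpointBelow {x} ¬Xx Xy y≤x with upperEndpoint Xy
    ... | inj₁ y↑⊆X = ⊥-elim (¬Xx (y↑⊆X y≤x))
    ... | inj₂ (e , e∈ , y≤e , [y,e]⊆X) with ≤⊎> x e
    ...   | inj₁ x≤e = ⊥-elim (¬Xx ([y,e]⊆X y≤x x≤e))
    ...   | inj₂ e<x = e , e∈ , y≤e , e<x , [y,e]⊆X

    ∈⇒fromEndpoints : ∀ {x} → X x → fromEndpoints (lˢ I X) (rˢ I X) x
    ∈⇒fromEndpoints {x} Xx with lowerEndpoint Xx
    ... | e , e∈ , e≤x , [e,x]⊆X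
        with minimalIn {P = λ e → e ≤ x × [ e , x ]⊆ X} <-trans <-irrefl _ (lose e∈ (e≤x , [e,x]⊆X))
    ...   | a , _ , (a≤x , [a,x]⊆X) , a-min = a , ([a,x]⊆X ≤-refl a≤x , a-left) , a≤x , misses
      where
      a-left : ∀ y → SameComp I X a y → ¬ y < a
      a-left y sc y<a with lowerEndpoint (SameComp⇒⊆ (SameComp-sym sc) ≤-refl (inj₁ y<a))
      ... | e′ , e′∈ , e′≤y , [e′,y]⊆X =
        a-min e′∈ (≤-trans e′≤y (≤-trans (inj₁ y<a) a≤x) ,
                   ⊆-join (⊆-join [e′,y]⊆X (SameComp⇒⊆ (SameComp-sym sc))) [a,x]⊆X)
              (≤-<-trans e′≤y y<a)

      misses : Misses (rˢ I X) a x
      misses b (_ , b-right) a≤b b<x =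
        b-right x (⊆⇒SameComp (inj₁ b<x) (λ b≤z z≤x → [a,x]⊆X (≤-trans a≤b b≤z) z≤x)) b<x

    -- If x ∉ X, the largest interval upper bound b < x with [a, b] ⊆ X is a right end of X.
    fromEndpoints⇒∈ : ∀ {a x} → X a → a ≤ x → Misses (rˢ I X) a x → X x
    fromEndpoints⇒∈ {a} {x} Xa a≤x misses with decide (X x)
    ... | yes Xx = Xx
    ... | no ¬Xx with upperEndpointBelow ¬Xx Xa a≤x
    ... | e , e∈ , a≤e , e<x , [a,e]⊆X
        with minimalIn {P = λ e → a ≤ e × e < x × [ a , e ]⊆ X} (flip <-trans) (<-irrefl ∘ sym) _
                       (lose e∈ (a≤e , e<x , [a,e]⊆X))
    ...   | b , _ , (a≤b , b<x , [a,b]⊆X) , b-max = ⊥-elim (misses b ([a,b]⊆X a≤b ≤-refl , b-right) a≤b b<x)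
      where
      b-right : ∀ y → SameComp I X b y → ¬ b < y
      b-right y sc b<y with ≤⊎> x y
      ... | inj₁ x≤y = ¬Xx (SameComp⇒⊆ sc (inj₁ b<x) x≤y)
      ... | inj₂ y<x with upperEndpointBelow ¬Xx (SameComp⇒⊆ sc (inj₁ b<y) ≤-refl) (inj₁ y<x)
      ...   | k , k∈ , y≤k , k<x , [y,k]⊆X =
        b-max k∈ (≤-trans a≤b (≤-trans (inj₁ b<y) y≤k) , k<x ,
                  ⊆-join (⊆-join [a,b]⊆X (SameComp⇒⊆ sc)) [y,k]⊆X)
              (<-≤-trans b<y y≤k)

    fromEndpoints-lr : ∀ x → X x ⇔ fromEndpoints (lˢ I X) (rˢ I X) x
    fromEndpoints-lr x =
      mk⇔ ∈⇒fromEndpoints (λ (a , (Xa , _) , a≤x , misses) → fromEndpoints⇒∈ Xa a≤x misses)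

  module _ {Y Z : Subset I} (Y-finite : IsFinite I Y) (Z-finite : IsFinite I Z) where
    NextIn : Carrier → Carrier → Set
    NextIn a b = Z b × a ≤ b × Misses Z a b

    nextIn : ∀ {a b} → Z b → a ≤ b → ∃ (NextIn a)
    nextIn {a} Zb a≤b with minimalIn {P = λ b → Z b × a ≤ b} <-trans <-irrefl _
                                     (lose (proj₁ (proj₂ Z-finite _) Zb) (Zb , a≤b))
    ... | m , _ , (Zm , a≤m) , m-min =
      m , Zm , a≤m , λ b′ Zb′ a≤b′ → m-min (proj₁ (proj₂ Z-finite _) Zb′) (Zb′ , a≤b′)

    segment : (a : Carrier) → Dec (∃ (NextIn a)) → ClosedInterval I
    segment a (yes (b , _)) = [ a , b ]
    segment a (no _)        = [ a ,+∞]

    ∈-segment⇔ : ∀ {a x} next? → x ∈ᵢ segment a next? ⇔ (a ≤ x × Misses Z a x)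
    ∈-segment⇔ (yes (b , Zb , a≤b , b-next)) = mk⇔
      (λ (a≤x , x≤b) → a≤x , λ b′ Zb′ a≤b′ b′<x → b-next b′ Zb′ a≤b′ (<-≤-trans b′<x x≤b))
      (λ (a≤x , misses) → a≤x , ≮⇒≥ (misses b Zb a≤b))
    ∈-segment⇔ (no ∄next) = mk⇔
      (λ a≤x → a≤x , λ b′ Zb′ a≤b′ _ → ∄next (nextIn Zb′ a≤b′))
      proj₁

    fromEndpoints-fci : IsFci I (fromEndpoints Y Z)
    fromEndpoints-fci = map segment? ys , λ x → to , from
      where
      ys : List Carrier
      ys = proj₁ Y-finite
      segment? : Carrier → ClosedInterval I
      segment? a = segment a (decide (∃ (NextIn a)))
      to : ∀ {x} → fromEndpoints Y Z x → Any (x ∈ᵢ_) (map segment? ys)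
      to (a , Ya , a≤x , misses) =
        map⁺ (lose (proj₁ (proj₂ Y-finite a) Ya) (Equivalence.from (∈-segment⇔ _) (a≤x , misses)))
      from : ∀ {x} → Any (x ∈ᵢ_) (map segment? ys) → fromEndpoints Y Z x
      from x∈ with find (map⁻ x∈)
      ... | a , a∈ , x∈segment = a , proj₂ (proj₂ Y-finite a) a∈ , Equivalence.to (∈-segment⇔ _) x∈segment

isPoint : Fin m → Formula TermW m
isPoint v = (¬' (var v ≐ bot)) ∧' (min (var v) ≐ var v)

∀ₚ ∃ₚ : Formula TermW (suc m) → Formula TermW m
∀ₚ φ = ∀' (isPoint zero ⇒' φ)
∃ₚ φ = ∃' (isPoint zero ∧' φ)

_∈'_ _≤'_ _<'_ : Fin m → Fin m → Formula TermW m
p ∈' S = (var p ∩ var S) ≐ var p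
p ≤' q = min (var p ∪ var q) ≐ var p
p <' q = (p ≤' q) ∧' (¬' (var q ≐ var p))

isZero : Fin m → Formula TermW m
isZero p = zero𝟎 ≐ var p

_⇔'_ : Formula TermW m → Formula TermW m → Formula TermW m
φ ⇔' ψ = (φ ⇒' ψ) ∧' (ψ ⇒' φ)

fromEndpoints' : Fin m → Fin m → Fin m → Formula TermW m
fromEndpoints' y z p =
  ∃ₚ ((zero ∈' suc y) ∧' ((zero ≤' suc p) ∧'
      ∀ₚ ((zero ∈' suc (suc z)) ⇒' ((suc zero ≤' zero) ⇒' (¬' (zero <' suc (suc p)))))))

sameComponent : Formula TermW (suc m) → Fin m → Fin m → Formula TermW m
sameComponent M u v =
  ∀ₚ ((((suc u ≤' zero) ∧' (zero ≤' suc v)) ∨' ((suc v ≤' zero) ∧' (zero ≤' suc u))) ⇒' M)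

-- L-variable i is coded by the W-variables lvar i and rvar i, holding its left and right ends.
record EndpointVars (n m : ℕ) : Set where
  constructor endpointVars
  field
    lvar rvar : Fin n → Fin m
open EndpointVars

weaken : EndpointVars n m → EndpointVars n (suc m)
weaken e = endpointVars (suc ∘ lvar e) (suc ∘ rvar e)

bind : EndpointVars n m → EndpointVars (suc n) (suc (suc m))
bind e = endpointVars (λ { zero → suc zero ; (suc i) → suc (suc (lvar e i)) })
                      (λ { zero → zero     ; (suc i) → suc (suc (rvar e i)) })

nothingBelow nothingAbove : Formula TermW (suc m) → Fin m → Formula TermW m
nothingBelow R p = ∀ₚ (R ⇒' (¬' (zero <' suc p)))
nothingAbove R p = ∀ₚ (R ⇒' (¬' (suc p <' zero)))

lrVars : ∀ n → EndpointVars n (n + n)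
lrVars n = endpointVars (_↑ˡ n) (n ↑ʳ_)

mem : TermL n → EndpointVars n m → Fin m → Formula TermW m
mem (var i) e p = fromEndpoints' (lvar e i) (rvar e i) p
mem (t ∪ u) e p = mem t e p ∨' mem u e p
mem (t ∩ u) e p = mem t e p ∧' mem u e p
mem bot     e p = ⊥'
mem zero𝟎   e p = isZero p
mem (min t) e p = mem t e p ∧' nothingBelow (mem t (weaken e) zero) p
mem (max t) e p = mem t e p ∧' nothingAbove (mem t (weaken e) zero) p
mem (l t)   e p = mem t e p ∧' nothingBelow (sameComponent (mem t (weaken (weaken e)) zero) (suc p) zero) p
mem (r t)   e p = mem t e p ∧' nothingAbove (sameComponent (mem t (weaken (weaken e)) zero) (suc p) zero) p

translate : Formula TermL n → EndpointVars n m → Formula TermW m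
translate (t ≐ u)  e = ∀ₚ (mem t (weaken e) zero ⇔' mem u (weaken e) zero)
translate ⊥'       e = ⊥'
translate (¬' φ)   e = ¬' translate φ e
translate (φ ∧' ψ) e = translate φ e ∧' translate ψ e
translate (φ ∨' ψ) e = translate φ e ∨' translate ψ e
translate (φ ⇒' ψ) e = translate φ e ⇒' translate ψ e
translate (∀' φ)   e = ∀' (∀' (translate φ (bind e)))
translate (∃' φ)   e = ∃' (∃' (translate φ (bind e)))

module Translation (I : DLO) (em : ExcludedMiddle (lsuc lzero)) where
  open DLO I
  open Order I
  open Endpoints I em
  open Equivalence using (to; from)

  IsSingleton : Subset I → Carrier → Set
  IsSingleton X x = ∀ y → X y ⇔ (y ≡ x)

  singleton-≡ : ∀ {X x y} → IsSingleton X y → IsSingleton X x ⇔ (x ≡ y)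
  singleton-≡ {X} {x} X≈y = mk⇔ (λ X≈x → to (X≈y x) (from (X≈x x) refl)) (λ { refl → X≈y })

  singleton-∩ˢ : ∀ {X S x} → IsSingleton X x → IsSingleton (_∩ˢ_ I X S) x ⇔ S x
  singleton-∩ˢ {x = x} X≈x = mk⇔
    (λ X∩S≈x → proj₂ (from (X∩S≈x x) refl))
    (λ Sx y → mk⇔ (λ (Xy , _) → to (X≈x y) Xy) (λ { refl → from (X≈x x) refl , Sx }))

  singleton-min∪ : ∀ {X Y x y} → IsSingleton X x → IsSingleton Y y →
                   IsSingleton (minˢ I (_∪ˢ_ I X Y)) x ⇔ x ≤ y
  singleton-min∪ {X} {Y} {x} {y} X≈x Y≈y = mk⇔
    (λ min≈x → ≮⇒≥ (proj₂ (from (min≈x x) refl) y (inj₂ (from (Y≈y y) refl))))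
    (λ x≤y z → mk⇔ (minimal⇒≡ x≤y) (λ { refl → inj₁ (from (X≈x z) refl) , least-of x≤y }))
    where
    least-of : x ≤ y → ∀ w → (_∪ˢ_ I X Y) w → ¬ w < x
    least-of _   w (inj₁ Xw) w<x with to (X≈x w) Xw
    ... | refl = <-irrefl refl w<x
    least-of x≤y w (inj₂ Yw) w<x with to (Y≈y w) Yw
    ... | refl = ≤⇒≯ x≤y w<x
    minimal⇒≡ : ∀ {z} → x ≤ y → minˢ I (_∪ˢ_ I X Y) z → z ≡ x
    minimal⇒≡ _   (inj₁ Xz , _) = to (X≈x _) Xz
    minimal⇒≡ x≤y (inj₂ Yz , z-min) with to (Y≈y _) Yz
    ... | refl = sym (≤∧≮⇒≡ x≤y (z-min x (inj₁ (from (X≈x x) refl))))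

  ⊨¬ : ∀ {a b ℓ} {A : Set a} {B : Set b} → A ⇔ B → (A → Lift ℓ ⊥) ⇔ (¬ B)
  ⊨¬ A⇔B = →-cong-⇔ A⇔B (mk⇔ lower lift)

  module _ {m} (ρ : Env I m) where
    ⊨≐var : ∀ (t : TermW m) p {x} → IsSingleton (ρ p) x →
            ⊨W I (t ≐ var p) ρ ⇔ IsSingleton (evalW I t ρ) x
    ⊨≐var t p ρp≈x = mk⇔
      (λ (lift t≈p) y → mk⇔ (λ ty → to (ρp≈x y) (proj₁ (t≈p y) ty))
                            (λ y≡x → proj₂ (t≈p y) (from (ρp≈x y) y≡x)))
      (λ t≈x → lift λ y → (λ ty → from (ρp≈x y) (to (t≈x y) ty)) ,
                          (λ ρpy → from (t≈x y) (to (ρp≈x y) ρpy)))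

    ⊨∈' : ∀ p S {x} → IsSingleton (ρ p) x → ⊨W I (p ∈' S) ρ ⇔ ρ S x
    ⊨∈' p S ρp≈x = ⇔-trans (⊨≐var (var p ∩ var S) p ρp≈x) (singleton-∩ˢ ρp≈x)

    ⊨≤' : ∀ p q {x y} → IsSingleton (ρ p) x → IsSingleton (ρ q) y → ⊨W I (p ≤' q) ρ ⇔ x ≤ y
    ⊨≤' p q ρp≈x ρq≈y = ⇔-trans (⊨≐var (min (var p ∪ var q)) p ρp≈x) (singleton-min∪ ρp≈x ρq≈y)

    ⊨<' : ∀ p q {x y} → IsSingleton (ρ p) x → IsSingleton (ρ q) y → ⊨W I (p <' q) ρ ⇔ x < y
    ⊨<' p q ρp≈x ρq≈y =
      ⇔-trans (⊨≤' p q ρp≈x ρq≈y ×-⇔ ⊨¬ (⇔-trans (⊨≐var (var q) p ρp≈x) (singleton-≡ ρq≈y))) ≤∧≢⇔<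

    ⊨isZero : ∀ p {x} → IsSingleton (ρ p) x → ⊨W I (isZero p) ρ ⇔ (x ≡ 0#)
    ⊨isZero p ρp≈x = ⇔-trans (⊨≐var zero𝟎 p ρp≈x) (singleton-≡ (λ y → ⇔-id (y ≡ 0#)))

    ⊨isPoint : ∀ v {x} → IsSingleton (ρ v) x → ⊨W I (isPoint v) ρ
    ⊨isPoint v {x} ρv≈x =
      (λ (lift ρv≈∅) → lift (proj₁ (ρv≈∅ x) (from (ρv≈x x) refl))) ,
      lift λ y → proj₁ , λ ρvy → ρvy , λ w ρvw →
        <-irrefl (trans (to (ρv≈x w) ρvw) (sym (to (ρv≈x y) ρvy)))

    isPoint⇒singleton : ∀ v → IsFinite I (ρ v) → ⊨W I (isPoint v) ρ → ∃ (IsSingleton (ρ v))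
    isPoint⇒singleton v ([] , ρv≈[]) (ρv≉∅ , _) =
      ⊥-elim (lower (ρv≉∅ (lift λ y → (λ ρvy → ¬Any[] (proj₁ (ρv≈[] y) ρvy)) , λ ())))
    isPoint⇒singleton v (x ∷ _ , ρv≈xs) (_ , lift min≈ρv) = x , λ y → mk⇔ ≡x (λ { refl → ρvx })
      where
      ρvx : ρ v x
      ρvx = proj₂ (ρv≈xs x) (here refl)
      minimal : ∀ {y} → ρ v y → ∀ w → ρ v w → ¬ w < y
      minimal ρvy = proj₂ (proj₂ (min≈ρv _) ρvy)
      ≡x : ∀ {y} → ρ v y → y ≡ x
      ≡x {y} ρvy with compare y x
      ... | tri< y<x _ _ = ⊥-elim (minimal ρvx y ρvy y<x)
      ... | tri≈ _ y≡x _ = y≡x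
      ... | tri> _ _ x<y = ⊥-elim (minimal ρvy x ρvx x<y)

  ≡-singleton : ∀ z → IsSingleton (_≡ z) z
  ≡-singleton z y = ⇔-id (y ≡ z)

  ≡-finite : ∀ z → IsFinite I (_≡ z)
  ≡-finite z = z ∷ [] , λ y → (λ { refl → here refl }) , λ { (here y≡z) → y≡z }

  module _ {m} (ρ : Env I m) {a} {Q : Carrier → Set a} (φ : Formula TermW (suc m))
           (φ⇔Q : ∀ {X z} → IsSingleton X z → ⊨W I φ (extend I X ρ) ⇔ Q z) where
    private
      point : ∀ z → ⊨W I (isPoint zero) (extend I (_≡ z) ρ)
      point z = ⊨isPoint (extend I (_≡ z) ρ) zero (≡-singleton z)

      point⇒singleton : ∀ {X} → IsFinite I X → ⊨W I (isPoint zero) (extend I X ρ) → ∃ (IsSingleton X)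
      point⇒singleton {X} = isPoint⇒singleton (extend I X ρ) zero

    ⊨∀ₚ : ⊨W I (∀ₚ φ) ρ ⇔ (∀ z → Q z)
    ⊨∀ₚ = mk⇔
      (λ ∀φ z → to (φ⇔Q (≡-singleton z)) (∀φ _ (≡-finite z) (point z)))
      (λ ∀Q X X-finite X-point → let (z , X≈z) = point⇒singleton X-finite X-point in from (φ⇔Q X≈z) (∀Q z))

    ⊨∃ₚ : ⊨W I (∃ₚ φ) ρ ⇔ ∃ Q
    ⊨∃ₚ = mk⇔
      (λ (X , X-finite , X-point , φX) →
        let (z , X≈z) = point⇒singleton X-finite X-point in z , to (φ⇔Q X≈z) φX)
      (λ (z , Qz) → _ , ≡-finite z , point z , from (φ⇔Q (≡-singleton z)) Qz)

  ⊨fromEndpoints' : ∀ {m} (ρ : Env I m) y z p {x} → IsSingleton (ρ p) x →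
                    ⊨W I (fromEndpoints' y z p) ρ ⇔ fromEndpoints (ρ y) (ρ z) x
  ⊨fromEndpoints' {m} ρ y z p ρp≈x =
    ⊨∃ₚ ρ ((zero ∈' suc y) ∧' ((zero ≤' suc p) ∧' ∀ₚ misses)) λ {X} X≈a →
    let ρ₁ = extend I X ρ in
    ⊨∈' ρ₁ zero (suc y) X≈a ×-⇔ (⊨≤' ρ₁ zero (suc p) X≈a ρp≈x ×-⇔ ⊨∀ₚ ρ₁ misses λ {X′} X′≈b →
      let ρ₂ = extend I X′ ρ₁ in
      →-cong-⇔ (⊨∈' ρ₂ zero (suc (suc z)) X′≈b)
               (→-cong-⇔ (⊨≤' ρ₂ (suc zero) zero X≈a X′≈b) (⊨¬ (⊨<' ρ₂ zero (suc (suc p)) X′≈b ρp≈x))))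
    where
    misses : Formula TermW (suc (suc m))
    misses = (zero ∈' suc (suc z)) ⇒' ((suc zero ≤' zero) ⇒' (¬' (zero <' suc (suc p))))

  ⊨sameComponent : ∀ {m} (ρ : Env I m) M u v {x y} {E : Subset I} →
                   IsSingleton (ρ u) x → IsSingleton (ρ v) y →
                   (∀ {X z} → IsSingleton X z → ⊨W I M (extend I X ρ) ⇔ E z) →
                   ⊨W I (sameComponent M u v) ρ ⇔ SameComp I E x y
  ⊨sameComponent {m} ρ M u v ρu≈x ρv≈y M⇔E = ⊨∀ₚ ρ between⇒M λ {X} X≈z →
    let ρ₁ = extend I X ρ in
    →-cong-⇔ ((⊨≤' ρ₁ (suc u) zero ρu≈x X≈z ×-⇔ ⊨≤' ρ₁ zero (suc v) X≈z ρv≈y) ⊎-⇔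
              (⊨≤' ρ₁ (suc v) zero ρv≈y X≈z ×-⇔ ⊨≤' ρ₁ zero (suc u) X≈z ρu≈x))
             (M⇔E X≈z)
    where
    between⇒M : Formula TermW (suc m)
    between⇒M = (((suc u ≤' zero) ∧' (zero ≤' suc v)) ∨' ((suc v ≤' zero) ∧' (zero ≤' suc u))) ⇒' M

  module _ {m} (ρ : Env I m) (R : Formula TermW (suc m)) p {S : Subset I} {x}
           (R⇔S : ∀ {X z} → IsSingleton X z → ⊨W I R (extend I X ρ) ⇔ S z)
           (ρp≈x : IsSingleton (ρ p) x) where
    ⊨nothingBelow : ⊨W I (nothingBelow R p) ρ ⇔ (∀ y → S y → ¬ y < x)
    ⊨nothingBelow = ⊨∀ₚ ρ (R ⇒' (¬' (zero <' suc p))) λ {X} X≈y →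
      →-cong-⇔ (R⇔S X≈y) (⊨¬ (⊨<' (extend I X ρ) zero (suc p) X≈y ρp≈x))

    ⊨nothingAbove : ⊨W I (nothingAbove R p) ρ ⇔ (∀ y → S y → ¬ x < y)
    ⊨nothingAbove = ⊨∀ₚ ρ (R ⇒' (¬' (suc p <' zero))) λ {X} X≈y →
      →-cong-⇔ (R⇔S X≈y) (⊨¬ (⊨<' (extend I X ρ) (suc p) zero ρp≈x X≈y))

  Codes : Env I m → Env I n → EndpointVars n m → Set
  Codes ρ A e = ∀ i x → A i x ⇔ fromEndpoints (ρ (lvar e i)) (ρ (rvar e i)) x

  ⊨mem : ∀ {ρ : Env I m} {A : Env I n} {e p x} (t : TermL n) →
         Codes ρ A e → IsSingleton (ρ p) x → ⊨W I (mem t e p) ρ ⇔ evalL I t A x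
  ⊨mem {ρ = ρ} {e = e} {p} (var i) codes ρp≈x =
    ⇔-trans (⊨fromEndpoints' ρ (lvar e i) (rvar e i) p ρp≈x) (⇔-sym (codes i _))
  ⊨mem (t ∪ u) codes ρp≈x = ⊨mem t codes ρp≈x ⊎-⇔ ⊨mem u codes ρp≈x
  ⊨mem (t ∩ u) codes ρp≈x = ⊨mem t codes ρp≈x ×-⇔ ⊨mem u codes ρp≈x
  ⊨mem bot     _     _    = mk⇔ lower lift
  ⊨mem {ρ = ρ} {p = p} zero𝟎 _ ρp≈x = ⊨isZero ρ p ρp≈x
  ⊨mem {ρ = ρ} {e = e} {p} (min t) codes ρp≈x =
    ⊨mem t codes ρp≈x ×-⇔ ⊨nothingBelow ρ (mem t (weaken e) zero) p (⊨mem t codes) ρp≈x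
  ⊨mem {ρ = ρ} {e = e} {p} (max t) codes ρp≈x =
    ⊨mem t codes ρp≈x ×-⇔ ⊨nothingAbove ρ (mem t (weaken e) zero) p (⊨mem t codes) ρp≈x
  ⊨mem {ρ = ρ} {e = e} {p} (l t) codes ρp≈x =
    ⊨mem t codes ρp≈x ×-⇔
    ⊨nothingBelow ρ (sameComponent (mem t (weaken (weaken e)) zero) (suc p) zero) p
      (λ {X} X≈y → ⊨sameComponent (extend I X ρ) _ (suc p) zero ρp≈x X≈y (⊨mem t codes)) ρp≈x
  ⊨mem {ρ = ρ} {e = e} {p} (r t) codes ρp≈x =
    ⊨mem t codes ρp≈x ×-⇔
    ⊨nothingAbove ρ (sameComponent (mem t (weaken (weaken e)) zero) (suc p) zero) p
      (λ {X} X≈y → ⊨sameComponent (extend I X ρ) _ (suc p) zero ρp≈x X≈y (⊨mem t codes)) ρp≈x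

  bind-codes : ∀ {ρ : Env I m} {A : Env I n} {e X Y Z} → Codes ρ A e →
               (∀ x → X x ⇔ fromEndpoints Y Z x) → Codes (extend I Z (extend I Y ρ)) (extend I X A) (bind e)
  bind-codes _     X≈YZ zero    = X≈YZ
  bind-codes codes _    (suc i) = codes i

  ⊨translate : ∀ {ρ : Env I m} {A : Env I n} {e} (φ : Formula TermL n) →
               Codes ρ A e → ⊨L I φ A ⇔ ⊨W I (translate φ e) ρ
  ⊨translate {ρ = ρ} {e = e} (t ≐ u) codes = ⇔-trans (mk⇔ lower lift) (⇔-sym
    (⊨∀ₚ ρ (mem t (weaken e) zero ⇔' mem u (weaken e) zero) λ X≈z →
      →-cong-⇔ (⊨mem t codes X≈z) (⊨mem u codes X≈z) ×-⇔
      →-cong-⇔ (⊨mem u codes X≈z) (⊨mem t codes X≈z)))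
  ⊨translate ⊥'       _     = ⇔-id _
  ⊨translate (¬' φ)   codes = →-cong-⇔ (⊨translate φ codes) (⇔-id _)
  ⊨translate (φ ∧' ψ) codes = ⊨translate φ codes ×-⇔ ⊨translate ψ codes
  ⊨translate (φ ∨' ψ) codes = ⊨translate φ codes ⊎-⇔ ⊨translate ψ codes
  ⊨translate (φ ⇒' ψ) codes = →-cong-⇔ (⊨translate φ codes) (⊨translate ψ codes)
  ⊨translate (∀' φ)   codes = mk⇔
    (λ ∀X Y Y-finite Z Z-finite →
      to (⊨translate φ (bind-codes codes (λ _ → ⇔-id _))) (∀X _ (fromEndpoints-fci Y-finite Z-finite)))
    (λ ∀YZ X X-fci →
      from (⊨translate φ (bind-codes codes (fromEndpoints-lr X-fci))) (∀YZ _ (lˢ-finite X-fci) _ (rˢ-finite X-fci)))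
  ⊨translate (∃' φ)   codes = mk⇔
    (λ (X , X-fci , φX) → _ , lˢ-finite X-fci , _ , rˢ-finite X-fci ,
      to (⊨translate φ (bind-codes codes (fromEndpoints-lr X-fci))) φX)
    (λ (Y , Y-finite , Z , Z-finite , ψYZ) → _ , fromEndpoints-fci Y-finite Z-finite ,
      from (⊨translate φ (bind-codes codes (λ _ → ⇔-id _))) ψYZ)

  lrEnv-codes : ∀ {A : Env I n} → (∀ i → IsFci I (A i)) → Codes (lrEnv I n A) A (lrVars n)
  lrEnv-codes {n} A-fci i x rewrite splitAt-↑ˡ n i n | splitAt-↑ʳ n n i = fromEndpoints-lr (A-fci i) x

corollary6p14 : (I : DLO) → ExcludedMiddle (lsuc lzero) →
    (n : ℕ) (φ : Formula TermL n) →
    Σ (Formula TermW (n + n)) λ ψ →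
      (A : Fin n → Subset I) → (∀ i → IsFci I (A i)) →
      (⊨L I φ A ⇔ ⊨W I ψ (lrEnv I n A))
corollary6p14 I em n φ = translate φ (lrVars n) , λ _ A-fci → ⊨translate φ (lrEnv-codes A-fci)
  where open Translation I em
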